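{- There is an absolute constant $c>0$ such that for every simple graph $G$ with $n$ vertices and minimum degree $\delta>0$, contracting every $\delta$-edge-connected component of $G$ (each to a single vertex) leaves a multigraph with at most $c\,n/\delta$ vertices and at most $c\,n$ edges.
   Context: For $X\subseteq V(G)$, $d_G(X)$ is the number of edges with exactly one endpoint in $X$. For vertices $v\neq w$, $\lambda_G(v,w)$ is the minimum of $d_G(X)$ over all $X$ containing exactly one of $v,w$. The $k$-edge-connected components are the equivalence classes of the relation "$v=w$ or $\lambda_G(v,w)\geq k$". Contracting a vertex set $X$ identifies all vertices of $X$ into one vertex, keeps parallel edges and deletes resulting loops. -}

module Defs where

open import Data.Nat using (ℕ; zero; suc; _+_; _≤_; _<_)
open import Data.Fin using (Fin; toℕ)
open import Data.Bool using (Bool; true; false; _∧_; not)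
open import Data.Product using (_×_; _,_; Σ)
open import Data.Sum using (_⊎_)
open import Relation.Binary.PropositionalEquality using (_≡_; _≢_)
open import Relation.Nullary using (¬_)

sumF : {n : ℕ} → (Fin n → ℕ) → ℕ
sumF {zero}  f = 0
sumF {suc n} f = f Fin.zero + sumF (λ i → f (Fin.suc i))

indicator : Bool → ℕ
indicator true  = 1
indicator false = 0

count : {n : ℕ} → (Fin n → Bool) → ℕ
count p = sumF (λ i → indicator (p i))

record SimpleGraph (n : ℕ) : Set where
  field
    adj    : Fin n → Fin n → Bool
    sym    : ∀ u v → adj u v ≡ adj v u
    irrefl : ∀ v → adj v v ≡ false

open SimpleGraph public

VSet : ℕ → Set
VSet n = Fin n → Bool

degree : {n : ℕ} → SimpleGraph n → Fin n → ℕ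
degree G v = count (adj G v)

IsMinDegree : {n : ℕ} → SimpleGraph n → ℕ → Set
IsMinDegree {n} G δ = (∀ v → δ ≤ degree G v) × Σ (Fin n) (λ v → degree G v ≡ δ)

-- d_G(X): number of edges with exactly one endpoint in X
-- (each such edge {u,v} counted once, as the ordered pair with u ∈ X, v ∉ X)
dG : {n : ℕ} → SimpleGraph n → VSet n → ℕ
dG G X = sumF (λ u → count (λ v → X u ∧ (not (X v) ∧ adj G u v)))

LambdaAtLeast : {n : ℕ} → SimpleGraph n → ℕ → Fin n → Fin n → Set
LambdaAtLeast {n} G k v w = (X : VSet n) → X v ≢ X w → k ≤ dG G X

SameComp : {n : ℕ} → SimpleGraph n → ℕ → Fin n → Fin n → Set
SameComp G k v w = v ≡ w ⊎ LambdaAtLeast G k v w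

-- The multigraph G/~ obtained by contracting every k-edge-connected
-- component has at most m vertices: any family of vertices of G lying
-- in pairwise distinct components has at most m members.
ContractedVerticesAtMost : {n : ℕ} → SimpleGraph n → ℕ → ℕ → Set
ContractedVerticesAtMost {n} G k m =
  (r : ℕ) (f : Fin r → Fin n) →
  (∀ i j → i ≢ j → ¬ SameComp G k (f i) (f j)) → r ≤ m

-- An edge of G surviving the contraction (joins two different components;
-- edges inside a component become loops and are deleted, parallel edges kept).
-- Edges {u,v} are represented by the ordered pair with toℕ u < toℕ v.
SurvivingEdge : {n : ℕ} → SimpleGraph n → ℕ → Fin n × Fin n → Set
SurvivingEdge G k (u , v) =
  (toℕ u < toℕ v) × (adj G u v ≡ true) × ¬ SameComp G k u v

-- The contracted multigraph has at most m edges: any family of distinct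
-- surviving edges has at most m members.
ContractedEdgesAtMost : {n : ℕ} → SimpleGraph n → ℕ → ℕ → Set
ContractedEdgesAtMost {n} G k m =
  (r : ℕ) (g : Fin r → Fin n × Fin n) →
  (∀ i j → g i ≡ g j → i ≡ j) →
  (∀ i → SurvivingEdge G k (g i)) → r ≤ m

module Submission where

-- Call a vertex set tight if it is a minimum cut between one of its vertices
-- and a vertex outside it. Since the cut function dG is submodular, minimum
-- cuts can be uncrossed with tight sets. Hence every node X (the whole vertex
-- set, or a tight set) decomposes into disjoint tight children with fewer than
-- δ boundary edges and a nonempty core inside one δ-edge-connected component.
-- By the minimum degree, a set with fewer than δ boundary edges has more than
-- δ vertices, and a set with three vertices and fewer than 2δ boundary edges
-- has at least δ/2. Consequently any measure growing by O(δ) per node of this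
-- recursive decomposition is O(n). The number of component representatives
-- (at most one per core) and the number of surviving edges (each meets a
-- child, and fewer than 2δ of them cross any child) are such measures.

open import Defs
open import Data.Nat using (ℕ; zero; suc; _+_; _*_; _≤_; _<_; _≤ᵇ_; _≤?_; _<?_; z≤n; s≤s; NonZero)
open import Data.Nat.DivMod using (_/_; m*n/n≡m; m/n*n≤m; /-monoˡ-≤)
open import Data.Nat.Properties hiding (_≟_)
open import Data.Nat.Tactic.RingSolver using (solve-∀)
open import Algebra.Properties.CommutativeSemigroup +-commutativeSemigroup using (interchange)
open import Data.Fin using (Fin; zero; suc; _≟_)
open import Data.Fin.Properties using () renaming (suc-injective to Fin-suc-injective)
open import Data.Bool using (Bool; true; false; _∧_; _∨_; not; T) renaming (_≟_ to _≟ᵇ_)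
open import Data.Bool.Properties
  using (T-∧; ∧-comm; ∧-zeroʳ; not-injective; not-involutive; ∧-conicalˡ; ∧-conicalʳ; ∨-conicalˡ; ∨-conicalʳ)
open import Data.Vec.Functional using (tail) renaming (_∷_ to _◂_)
open import Data.List using (List; []; _∷_; map; _++_; filter; length)
open import Data.Bool.ListAction using (any)
open import Data.List.Membership.Propositional using (_∈_)
open import Data.List.Membership.Propositional.Properties using (∈-map⁺; ∈-++⁺ˡ; ∈-++⁺ʳ; ∈-filter⁺)
open import Data.List.Relation.Unary.Any using (here)
open import Data.List.Relation.Unary.All as All using (All; []; _∷_; lookup)
open import Data.List.Relation.Unary.AllPairs using (AllPairs; []; _∷_)
open import Data.List.Relation.Unary.All.Properties using (all-filter)
open import Data.List.Extrema.Nat using (argmin; argmin-all; f[argmin]≤f[xs])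
open import Data.Product using (Σ; _×_; _,_; proj₁; proj₂)
open import Data.Sum using (_⊎_; inj₁; inj₂; [_,_])
open import Data.Empty using (⊥-elim)
open import Function using (Equivalence; _∘_)
open import Relation.Nullary using (¬_; ¬?; Dec; yes; no; does)
open import Relation.Binary.PropositionalEquality
  using (_≡_; _≢_; _≗_; ≢-sym; refl; cong; cong₂; trans; subst; module ≡-Reasoning) renaming (sym to ≡-sym)

sumF-cong : ∀ {n} {f g : Fin n → ℕ} → (∀ i → f i ≡ g i) → sumF f ≡ sumF g
sumF-cong {zero}  f≗g = refl
sumF-cong {suc n} f≗g = cong₂ _+_ (f≗g zero) (sumF-cong (λ i → f≗g (suc i)))

sumF-mono : ∀ {n} {f g : Fin n → ℕ} → (∀ i → f i ≤ g i) → sumF f ≤ sumF g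
sumF-mono {zero}  f≤g = z≤n
sumF-mono {suc n} f≤g = +-mono-≤ (f≤g zero) (sumF-mono (λ i → f≤g (suc i)))

sumF-zero : ∀ {n} {f : Fin n → ℕ} → (∀ i → f i ≡ 0) → sumF f ≡ 0
sumF-zero {zero}  f≗0 = refl
sumF-zero {suc n} f≗0 = cong₂ _+_ (f≗0 zero) (sumF-zero (λ i → f≗0 (suc i)))

sumF-+ : ∀ {n} (f g : Fin n → ℕ) → sumF (λ i → f i + g i) ≡ sumF f + sumF g
sumF-+ {zero}  f g = refl
sumF-+ {suc n} f g = trans (cong (f zero + g zero +_) (sumF-+ (λ i → f (suc i)) (λ i → g (suc i))))
                           (interchange (f zero) (g zero) _ _)

sumF-*ʳ : ∀ {n} (f : Fin n → ℕ) c → sumF (λ i → f i * c) ≡ sumF f * c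
sumF-*ʳ {zero}  f c = refl
sumF-*ʳ {suc n} f c = trans (cong (f zero * c +_) (sumF-*ʳ (λ i → f (suc i)) c))
                            (≡-sym (*-distribʳ-+ c (f zero) _))

sumF-swap : ∀ {m n} (f : Fin m → Fin n → ℕ) →
            sumF (λ i → sumF (f i)) ≡ sumF (λ j → sumF (λ i → f i j))
sumF-swap {zero} {n} f = ≡-sym (sumF-zero {n} (λ _ → refl))
sumF-swap {suc m} f = trans (cong (sumF (f zero) +_) (sumF-swap (λ i → f (suc i))))
                            (≡-sym (sumF-+ (f zero) _))

sumF²-+ : ∀ {m n} (f g : Fin m → Fin n → ℕ) →
  sumF (λ u → sumF (λ v → f u v + g u v)) ≡ sumF (λ u → sumF (f u)) + sumF (λ u → sumF (g u))
sumF²-+ f g = trans (sumF-cong (λ u → sumF-+ (f u) (g u))) (sumF-+ (λ u → sumF (f u)) (λ u → sumF (g u)))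

sumF-single : ∀ {n} (x : Fin n) (f : Fin n → ℕ) → (∀ i → i ≢ x → f i ≡ 0) → sumF f ≡ f x
sumF-single zero    f vanish = trans (cong (f zero +_) (sumF-zero (λ i → vanish (suc i) λ ()))) (+-identityʳ _)
sumF-single (suc x) f vanish =
  trans (cong (_+ sumF (λ i → f (suc i))) (vanish zero λ ()))
        (sumF-single x (λ i → f (suc i)) (λ i i≢x → vanish (suc i) (λ eq → i≢x (Fin-suc-injective eq))))

sumL : ∀ {A : Set} → (A → ℕ) → List A → ℕ
sumL f []       = 0
sumL f (x ∷ xs) = f x + sumL f xs

sumL-cong : ∀ {A : Set} {f g : A → ℕ} L → (∀ x → f x ≡ g x) → sumL f L ≡ sumL g L
sumL-cong []       f≗g = refl
sumL-cong (x ∷ xs) f≗g = cong₂ _+_ (f≗g x) (sumL-cong xs f≗g)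

sumL-mono : ∀ {A : Set} {P : A → Set} {f g : A → ℕ} {L} →
  All P L → (∀ {x} → P x → f x ≤ g x) → sumL f L ≤ sumL g L
sumL-mono []       f≤g = z≤n
sumL-mono (p ∷ ps) f≤g = +-mono-≤ (f≤g p) (sumL-mono ps f≤g)

sumL-*ˡ : ∀ {A : Set} c (f : A → ℕ) L → c * sumL f L ≡ sumL (λ x → c * f x) L
sumL-*ˡ c f []       = *-zeroʳ c
sumL-*ˡ c f (x ∷ xs) = trans (*-distribˡ-+ c (f x) _) (cong (c * f x +_) (sumL-*ˡ c f xs))

sumL-sumF : ∀ {A : Set} {n} (f : A → Fin n → ℕ) L →
  sumL (λ x → sumF (f x)) L ≡ sumF (λ i → sumL (λ x → f x i) L)
sumL-sumF {n = n} f []       = ≡-sym (sumF-zero {n} (λ _ → refl))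
sumL-sumF         f (x ∷ xs) = trans (cong (sumF (f x) +_) (sumL-sumF f xs)) (≡-sym (sumF-+ (f x) _))

point : ∀ {n} → Fin n → Fin n → Bool
point x v = does (v ≟ x)

indicator≤1 : ∀ b → indicator b ≤ 1
indicator≤1 true  = s≤s z≤n
indicator≤1 false = z≤n

count≤size : ∀ {n} (P : Fin n → Bool) → count P ≤ n
count≤size {zero}  P = z≤n
count≤size {suc n} P = +-mono-≤ (indicator≤1 (P zero)) (count≤size (λ i → P (suc i)))

count-full : ∀ {n} (P : Fin n → Bool) → (∀ i → P i ≡ true) → count P ≡ n
count-full {zero}  P full = refl
count-full {suc n} P full rewrite full zero = cong suc (count-full (λ i → P (suc i)) (λ i → full (suc i)))

point-self : ∀ {n} (x : Fin n) → point x x ≡ true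
point-self x with x ≟ x
... | yes _   = refl
... | no  x≢x = ⊥-elim (x≢x refl)

point-other : ∀ {n} {x i : Fin n} → i ≢ x → point x i ≡ false
point-other {x = x} {i} i≢x with i ≟ x
... | yes i≡x = ⊥-elim (i≢x i≡x)
... | no  _   = refl

point-sound : ∀ {n} {x i : Fin n} → point x i ≡ true → i ≡ x
point-sound {x = x} {i} eq with i ≟ x
... | yes i≡x = i≡x

count-point : ∀ {n} (x : Fin n) → count (point x) ≡ 1
count-point x = trans (sumF-single x _ (λ i i≢x → cong indicator (point-other i≢x)))
                      (cong indicator (point-self x))

indicator-mono : ∀ {a b} → (a ≡ true → b ≡ true) → indicator a ≤ indicator b
indicator-mono {false} a⇒b = z≤n
indicator-mono {true}  a⇒b rewrite a⇒b refl = s≤s z≤n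

count-mono : ∀ {n} {P Q : Fin n → Bool} → (∀ i → P i ≡ true → Q i ≡ true) → count P ≤ count Q
count-mono P⊆Q = sumF-mono (λ i → indicator-mono (P⊆Q i))

count-pos : ∀ {n} {P : Fin n → Bool} (x : Fin n) → P x ≡ true → 1 ≤ count P
count-pos {P = P} x Px = subst (_≤ count P) (count-point x)
  (count-mono {P = point x} (λ i at-x → subst (λ j → P j ≡ true) (≡-sym (point-sound at-x)) Px))

count-strict : ∀ {n} {P Q : Fin n → Bool} (x : Fin n) → (∀ i → Q i ≡ true → P i ≡ true) →
               P x ≡ true → Q x ≡ false → count Q < count P
count-strict {n} {P} {Q} x Q⊆P Px Qx =
  subst (_≤ count P) (trans (sumF-+ {n} _ _) (cong (_+ count Q) (count-point x))) (sumF-mono pointwise)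
  where
  pointwise : ∀ i → indicator (point x i) + indicator (Q i) ≤ indicator (P i)
  pointwise i with i ≟ x
  ... | yes refl rewrite Px | Qx = s≤s z≤n
  ... | no  _    = indicator-mono (Q⊆P i)

count-three : ∀ {n} {P : Fin n → Bool} {x y z : Fin n} → P x ≡ true → P y ≡ true → P z ≡ true →
  x ≢ y → x ≢ z → y ≢ z → 3 ≤ count P
count-three {n} {P} {x} {y} {z} Px Py Pz x≢y x≢z y≢z =
  ≤-trans (s≤s (≤-trans (s≤s (count-pos z (remains {P ─ x} (remains {P} Pz (≢-sym x≢z)) (≢-sym y≢z))))
                        (removal {P ─ x} (remains {P} Py (≢-sym x≢y)))))
          (removal {P} Px)
  where
  _─_ : (Fin n → Bool) → Fin n → Fin n → Bool
  (R ─ w) v = R v ∧ not (point w v)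
  remains : ∀ {R v w} → R v ≡ true → v ≢ w → (R ─ w) v ≡ true
  remains Rv v≢w rewrite Rv | point-other v≢w = refl
  removal : ∀ {R w} → R w ≡ true → count (R ─ w) < count R
  removal {R} {w} Rw = count-strict w (λ v → ∧-conicalˡ (R v) _) Rw removed
    where
    removed : (R ─ w) w ≡ false
    removed rewrite Rw | point-self w = refl

count≤1 : ∀ {r} (P : Fin r → Bool) → (∀ i j → P i ≡ true → P j ≡ true → i ≡ j) → count P ≤ 1
count≤1 {zero}  P unique = z≤n
count≤1 {suc r} P unique with P zero in P0
... | true  = ≤-reflexive (cong suc (sumF-zero (λ i → cong indicator (P-suc i))))
  where
  P-suc : ∀ i → P (suc i) ≡ false
  P-suc i with P (suc i) in Pi
  ... | false = refl
  ... | true  with unique zero (suc i) P0 Pi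
  ... | ()
... | false = count≤1 (λ i → P (suc i)) (λ i j Pi Pj → Fin-suc-injective (unique (suc i) (suc j) Pi Pj))

sumF-fibres : ∀ {r m} (g : Fin r → Fin m) (F : Fin r → ℕ) →
  sumF F ≡ sumF (λ u → sumF (λ i → indicator (point u (g i)) * F i))
sumF-fibres g F = trans (sumF-cong (λ i → ≡-sym (concentrated i))) (sumF-swap (λ i u → indicator (point u (g i)) * F i))
  where
  concentrated : ∀ i → sumF (λ u → indicator (point u (g i)) * F i) ≡ F i
  concentrated i =
    trans (sumF-single (g i) _ (λ u u≢gi → cong (λ b → indicator b * F i) (point-other (≢-sym u≢gi))))
          (trans (cong (λ b → indicator b * F i) (point-self (g i))) (+-identityʳ (F i)))

-- Summing a function of pairs along an injective family of pairs is
-- bounded by summing it over all pairs: each fibre has at most one member.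
sumF-injective-pairs : ∀ {r n} (g : Fin r → Fin n × Fin n) → (∀ i j → g i ≡ g j → i ≡ j) →
  (f : Fin n → Fin n → ℕ) → sumF (λ i → f (proj₁ (g i)) (proj₂ (g i))) ≤ sumF (λ u → sumF (f u))
sumF-injective-pairs {r} {n} g injective f = begin
  sumF F
    ≡⟨ sumF-fibres first F ⟩
  sumF (λ u → sumF (λ i → at first u i * F i))
    ≡⟨ sumF-cong (λ u → sumF-fibres second (λ i → at first u i * F i)) ⟩
  sumF (λ u → sumF (λ v → sumF (λ i → at second v i * (at first u i * F i))))
    ≤⟨ sumF-mono (λ u → sumF-mono (λ v → fibre u v)) ⟩
  sumF (λ u → sumF (f u))
    ∎
  where
  open ≤-Reasoning
  first second : Fin r → Fin n
  first i  = proj₁ (g i)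
  second i = proj₂ (g i)
  F : Fin r → ℕ
  F i = f (first i) (second i)
  at : (Fin r → Fin n) → Fin n → Fin r → ℕ
  at h u i = indicator (point u (h i))
  fibre : ∀ u v → sumF (λ i → at second v i * (at first u i * F i)) ≤ f u v
  fibre u v = begin
    sumF (λ i → at second v i * (at first u i * F i))  ≤⟨ sumF-mono term ⟩
    sumF (λ i → indicator (hits i) * f u v)            ≡⟨ sumF-*ʳ (λ i → indicator (hits i)) (f u v) ⟩
    count hits * f u v                                 ≤⟨ *-monoˡ-≤ (f u v) (count≤1 hits unique) ⟩
    1 * f u v                                          ≡⟨ *-identityˡ (f u v) ⟩
    f u v                                              ∎
    where
    hits : Fin r → Bool
    hits i = point u (first i) ∧ point v (second i)
    term : ∀ i → at second v i * (at first u i * F i) ≤ indicator (hits i) * f u v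
    term i with second i ≟ v | first i ≟ u
    ... | yes second≡v | yes first≡u = ≤-reflexive (begin-equality
      1 * (1 * F i)   ≡⟨ trans (*-identityˡ _) (*-identityˡ _) ⟩
      F i             ≡⟨ cong₂ f first≡u second≡v ⟩
      f u v           ≡⟨ ≡-sym (*-identityˡ _) ⟩
      1 * f u v       ∎)
    ... | yes _ | no _ = z≤n
    ... | no _  | _    = z≤n
    unique : ∀ i j → hits i ≡ true → hits j ≡ true → i ≡ j
    unique i j hit-i hit-j = injective i j (cong₂ _,_
      (trans (point-sound (∧-conicalˡ _ _ hit-i)) (≡-sym (point-sound (∧-conicalˡ _ _ hit-j))))
      (trans (point-sound (∧-conicalʳ _ _ hit-i)) (≡-sym (point-sound (∧-conicalʳ _ _ hit-j)))))

count-split : ∀ {n} (P Q : Fin n → Bool) → count P ≡ count (λ v → P v ∧ not (Q v)) + count (λ v → P v ∧ Q v)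
count-split {n} P Q = trans (sumF-cong (λ v → split (P v) (Q v))) (sumF-+ {n} _ _)
  where
  split : ∀ p q → indicator p ≡ indicator (p ∧ not q) + indicator (p ∧ q)
  split false q     = refl
  split true  true  = refl
  split true  false = refl

count-cong : ∀ {n} {P Q : Fin n → Bool} → P ≗ Q → count P ≡ count Q
count-cong P≗Q = sumF-cong (λ v → cong indicator (P≗Q v))

-- Deciding Boolean facts by evaluation: a predicate on Bool holds everywhere
-- iff it holds at both points, so a five-variable truth table becomes a closed
-- Boolean that the type checker evaluates.

everywhere : (Bool → Bool) → Bool
everywhere p = p true ∧ p false

everywhere-sound : (p : Bool → Bool) → T (everywhere p) → ∀ b → T (p b)
everywhere-sound p holds true  = proj₁ (Equivalence.to T-∧ holds)
everywhere-sound p holds false = proj₂ (Equivalence.to T-∧ holds)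

everywhere⁵ : (Bool → Bool → Bool → Bool → Bool → Bool) → Bool
everywhere⁵ p = everywhere λ a → everywhere λ b → everywhere λ c → everywhere λ d → everywhere (p a b c d)

everywhere⁵-sound : ∀ p → T (everywhere⁵ p) → ∀ a b c d e → T (p a b c d e)
everywhere⁵-sound p holds a b c d =
  everywhere-sound (p a b c d)
   (everywhere-sound (λ d → everywhere (p a b c d))
    (everywhere-sound (λ c → everywhere λ d → everywhere (p a b c d))
     (everywhere-sound (λ b → everywhere λ c → everywhere λ d → everywhere (p a b c d))
      (everywhere-sound (λ a → everywhere λ b → everywhere λ c → everywhere λ d → everywhere (p a b c d))
       holds a) b) c) d)

∁ : ∀ {n} → VSet n → VSet n
∁ X v = not (X v)

_∩_ : ∀ {n} → VSet n → VSet n → VSet n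
(X ∩ Y) v = X v ∧ Y v

_∪_ : ∀ {n} → VSet n → VSet n → VSet n
(X ∪ Y) v = X v ∨ Y v

infixr 7 _∩_
infixr 6 _∪_

_⊆_ : ∀ {n} → VSet n → VSet n → Set
X ⊆ Y = ∀ v → X v ≡ true → Y v ≡ true

Disjoint : ∀ {n} → VSet n → VSet n → Set
Disjoint X Y = ∀ v → X v ≡ true → Y v ≡ false

∨-false : ∀ {a b} → a ≡ false → b ≡ false → a ∨ b ≡ false
∨-false refl refl = refl

∨-true-elim : ∀ a {b} → a ∨ b ≡ true → a ≡ true ⊎ b ≡ true
∨-true-elim true  _      = inj₁ refl
∨-true-elim false b≡true = inj₂ b≡true

∨-true : ∀ a {b} → b ≡ true → a ∨ b ≡ true
∨-true true  _    = refl
∨-true false refl = refl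

Disjoint-sym : ∀ {n} {X Y : VSet n} → Disjoint X Y → Disjoint Y X
Disjoint-sym {X = X} X#Y v Yv with X v in Xv
... | true  with trans (≡-sym Yv) (X#Y v Xv)
...   | ()
Disjoint-sym _ _ _ | false = refl

count-difference : ∀ {n} {W X : VSet n} → W ⊆ X → count X ≡ count (X ∩ ∁ W) + count W
count-difference {W = W} {X} W⊆X = trans (count-split X W) (cong (count (X ∩ ∁ W) +_) (count-cong inside))
  where
  inside : ∀ v → X v ∧ W v ≡ W v
  inside v with W v in Wv
  ... | true  rewrite W⊆X v Wv = refl
  ... | false = ∧-zeroʳ (X v)

outside : ∀ {n} {X Y : VSet n} {v} → X ⊆ Y → Y v ≡ false → X v ≡ false
outside {X = X} {v = v} X⊆Y Yv with X v in Xv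
... | false = refl
... | true  with trans (≡-sym (X⊆Y v Xv)) Yv
...   | ()

differ : ∀ {n} {S : VSet n} {v w} → S v ≡ false → S w ≡ true → v ≢ w
differ Sv Sw refl with trans (≡-sym Sv) Sw
... | ()

covered : ∀ {n} → List (VSet n) → VSet n
covered L v = any (λ C → C v) L

subsets : ∀ m → List (VSet m)
subsets zero    = (λ ()) ∷ []
subsets (suc m) = map (false ◂_) (subsets m) ++ map (true ◂_) (subsets m)

subsets-complete : ∀ m (X : VSet m) → Σ (VSet m) λ Y → Y ∈ subsets m × Y ≗ X
subsets-complete zero    X = (λ ()) , here refl , (λ ())
subsets-complete (suc m) X with subsets-complete m (tail X)
... | Y , Y∈ , Y≗ = (X zero ◂ Y) , extend (X zero) Y∈ , λ { zero → refl ; (suc i) → Y≗ i }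
  where
  extend : ∀ b {Y} → Y ∈ subsets m → (b ◂ Y) ∈ subsets (suc m)
  extend false Y∈ = ∈-++⁺ˡ (∈-map⁺ (false ◂_) Y∈)
  extend true  Y∈ = ∈-++⁺ʳ _ (∈-map⁺ (true ◂_) Y∈)

search : ∀ {m} {P Q : Fin m → Set} → (∀ i → P i ⊎ Q i) → Σ (Fin m) P ⊎ (∀ i → Q i)
search {zero}  decide = inj₂ λ ()
search {suc m} decide with decide zero | search (λ i → decide (suc i))
... | inj₁ p | _              = inj₁ (zero , p)
... | inj₂ q | inj₁ (i , p)   = inj₁ (suc i , p)
... | inj₂ q | inj₂ qs        = inj₂ λ { zero → q ; (suc i) → qs i }

-- for 1 ≤ s ≤ δ: s (δ + 1) - s² - δ = (s - 1)(δ - s) ≥ 0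
quadratic-leaf : ∀ {s δ} → 1 ≤ s → s ≤ δ → δ + s * s ≤ s * suc δ
quadratic-leaf {suc r} _ s≤δ with m≤n⇒∃[o]m+o≡n s≤δ
... | t , refl = ≤-trans (m≤m+n _ (r * t)) (≤-reflexive (identity r t))
  where
  identity : ∀ r t → (suc r + t) + suc r * suc r + r * t ≡ suc r * suc (suc r + t)
  identity = solve-∀

-- for s = 3 + r and δ = 2s + 1 + t: s (δ + 1) - s² - 2δ = 1 + 4r + r² + t + rt > 0
quadratic-chain : ∀ {s δ} → 3 ≤ s → suc (s + s) ≤ δ → δ + δ + s * s < s * suc δ
quadratic-chain {s} s≥3 2s<δ with m≤n⇒∃[o]m+o≡n s≥3 | m≤n⇒∃[o]m+o≡n 2s<δ
... | r , refl | t , refl = ≤-trans (m≤m+n _ (4 * r + r * r + t + r * t)) (≤-reflexive (identity r t))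
  where
  identity : ∀ r t → let s = 3 + r ; δ = suc (s + s) + t in
    suc (δ + δ + s * s) + (4 * r + r * r + t + r * t) ≡ s * suc δ
  identity = solve-∀

exiting : Bool → Bool → Bool → ℕ
exiting a x y = indicator (x ∧ (not y ∧ a))

exiting-submodular : ∀ a x₁ x₂ y₁ y₂ →
  exiting a (x₁ ∧ y₁) (x₂ ∧ y₂) + exiting a (x₁ ∨ y₁) (x₂ ∨ y₂)
    ≤ exiting a x₁ x₂ + exiting a y₁ y₂
exiting-submodular a x₁ x₂ y₁ y₂ = ≤ᵇ⇒≤ _ _ (everywhere⁵-sound holds _ a x₁ x₂ y₁ y₂)
  where
  holds : Bool → Bool → Bool → Bool → Bool → Bool
  holds a x₁ x₂ y₁ y₂ =
    (exiting a (x₁ ∧ y₁) (x₂ ∧ y₂) + exiting a (x₁ ∨ y₁) (x₂ ∨ y₂))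
      ≤ᵇ (exiting a x₁ x₂ + exiting a y₁ y₂)

module Cuts {n} (G : SimpleGraph n) where

  crossing : VSet n → Fin n → Fin n → ℕ
  crossing X u v = exiting (adj G u v) (X u) (X v)

  dG-cong : ∀ {X Y} → X ≗ Y → dG G X ≡ dG G Y
  dG-cong X≗Y = sumF-cong λ u → sumF-cong λ v →
    cong₂ (exiting (adj G u v)) (X≗Y u) (X≗Y v)

  dG-∁ : ∀ X → dG G (∁ X) ≡ dG G X
  dG-∁ X = begin
    dG G (∁ X)                                           ≡⟨ sumF-cong (λ u → sumF-cong λ v → reversed u v) ⟩
    sumF (λ u → sumF (λ v → crossing X v u))             ≡⟨ ≡-sym (sumF-swap (crossing X)) ⟩
    dG G X                                               ∎
    where
    open ≡-Reasoning
    flip : ∀ x y a → indicator (not x ∧ (not (not y) ∧ a)) ≡ indicator (y ∧ (not x ∧ a))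
    flip x     true  a = refl
    flip true  false a = refl
    flip false false a = refl
    reversed : ∀ u v → crossing (∁ X) u v ≡ crossing X v u
    reversed u v rewrite SimpleGraph.sym G v u = flip (X u) (X v) (adj G u v)

  dG-submodular : ∀ X Y → dG G (X ∩ Y) + dG G (X ∪ Y) ≤ dG G X + dG G Y
  dG-submodular X Y = begin
    dG G (X ∩ Y) + dG G (X ∪ Y)
      ≡⟨ ≡-sym (sumF²-+ (crossing (X ∩ Y)) (crossing (X ∪ Y))) ⟩
    sumF (λ u → sumF (λ v → crossing (X ∩ Y) u v + crossing (X ∪ Y) u v))
      ≤⟨ sumF-mono (λ u → sumF-mono λ v → exiting-submodular (adj G u v) (X u) (X v) (Y u) (Y v)) ⟩
    sumF (λ u → sumF (λ v → crossing X u v + crossing Y u v))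
      ≡⟨ sumF²-+ (crossing X) (crossing Y) ⟩
    dG G X + dG G Y
      ∎
    where open ≤-Reasoning

  dG-diff : ∀ X Y → dG G (X ∩ ∁ Y) ≤ dG G X + dG G Y
  dG-diff X Y = ≤-trans (m≤m+n _ _)
    (≤-trans (dG-submodular X (∁ Y)) (≤-reflexive (cong (dG G X +_) (dG-∁ Y))))

  Separates : Fin n → Fin n → VSet n → Set
  Separates u v X = X u ≢ X v

  MinCut : Fin n → Fin n → VSet n → Set
  MinCut u v X = Separates u v X × (∀ Y → Separates u v Y → dG G X ≤ dG G Y)

  MinCut-cong : ∀ {u v X Y} → X ≗ Y → MinCut u v X → MinCut u v Y
  MinCut-cong {u} {v} X≗Y (sep , min) =
    (λ eq → sep (trans (X≗Y u) (trans eq (≡-sym (X≗Y v))))) ,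
    (λ Z sepZ → subst (_≤ dG G Z) (dG-cong X≗Y) (min Z sepZ))

  MinCut-∁ : ∀ {u v X} → MinCut u v X → MinCut u v (∁ X)
  MinCut-∁ {X = X} (sep , min) =
    (λ eq → sep (not-injective eq)) , (λ Y sepY → subst (_≤ dG G Y) (≡-sym (dG-∁ X)) (min Y sepY))

  MinCut-sym : ∀ {u v X} → MinCut u v X → MinCut v u X
  MinCut-sym (sep , min) = ≢-sym sep , (λ Y sepY → min Y (≢-sym sepY))

  minCut : ∀ {u v} → u ≢ v → Σ (VSet n) (MinCut u v)
  minCut {u} {v} u≢v = best , separated , minimal
    where
    separates? : ∀ X → Dec (Separates u v X)
    separates? X = ¬? (X u ≟ᵇ X v)
    candidates : List (VSet n)
    candidates = filter separates? (subsets n)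
    best : VSet n
    best = argmin (dG G) (point u) candidates
    point-separates : Separates u v (point u)
    point-separates eq with trans (≡-sym (point-self u)) (trans eq (point-other (≢-sym u≢v)))
    ... | ()
    separated : Separates u v best
    separated = argmin-all (dG G) point-separates (all-filter separates? (subsets n))
    minimal : ∀ Y → Separates u v Y → dG G best ≤ dG G Y
    minimal Y sepY with subsets-complete n Y
    ... | Y′ , Y′∈ , Y′≗Y =
      ≤-trans (lookup (f[argmin]≤f[xs] (point u) candidates) (∈-filter⁺ separates? Y′∈ sepY′))
              (≤-reflexive (dG-cong Y′≗Y))
      where
      sepY′ : Separates u v Y′
      sepY′ eq = sepY (trans (≡-sym (Y′≗Y u)) (trans eq (Y′≗Y v)))

  Tight : VSet n → Set
  Tight X = Σ (Fin n) λ s → Σ (Fin n) λ t → X s ≡ true × X t ≡ false × MinCut s t X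

  Tight-∁ : ∀ {X} → Tight X → Tight (∁ X)
  Tight-∁ (s , t , Xs , Xt , min) = t , s , cong not Xt , cong not Xs , MinCut-sym (MinCut-∁ min)

  exchange : ∀ Y Z → dG G Y ≤ dG G (Y ∪ Z) → dG G (Y ∩ Z) ≤ dG G Z
  exchange Y Z Y≤Y∪Z = +-cancelʳ-≤ (dG G Y) (dG G (Y ∩ Z)) (dG G Z)
    (≤-trans (+-monoʳ-≤ (dG G (Y ∩ Z)) Y≤Y∪Z)
      (≤-trans (dG-submodular Y Z) (≤-reflexive (+-comm (dG G Y) (dG G Z)))))

  uncross-avoiding : ∀ {Y Z u v} (s t : Fin n) → Y s ≡ true → Y t ≡ false → MinCut s t Y →
    Y u ≡ true → Y v ≡ true → MinCut u v Z → Z t ≡ false → MinCut u v (Y ∩ Z)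
  uncross-avoiding {Y} {Z} {u} {v} s t Ys Yt (_ , minY) Yu Yv (sepZ , minZ) Zt =
    separates , λ W sepW → ≤-trans (exchange Y Z (minY (Y ∪ Z) s-t-separated)) (minZ W sepW)
    where
    separates : Separates u v (Y ∩ Z)
    separates rewrite Yu | Yv = sepZ
    s-t-separated : Separates s t (Y ∪ Z)
    s-t-separated rewrite Ys | Yt | Zt = λ ()

  uncross : ∀ {Y Z u v} → Tight Y → Y u ≡ true → Y v ≡ true → MinCut u v Z →
    MinCut u v (Y ∩ Z) ⊎ MinCut u v (Y ∩ ∁ Z)
  uncross {Z = Z} (s , t , Ys , Yt , minY) Yu Yv minZ with Z t in Zt
  ... | false = inj₁ (uncross-avoiding s t Ys Yt minY Yu Yv minZ Zt)
  ... | true  = inj₂ (uncross-avoiding s t Ys Yt minY Yu Yv (MinCut-∁ minZ) (cong not Zt))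

  uncross-outside : ∀ {C W u v} → Tight C → C u ≡ false → C v ≡ false → MinCut u v W →
    MinCut u v (∁ C ∩ W) ⊎ MinCut u v (C ∪ W)
  uncross-outside {C} {W} tight Cu Cv minW with uncross (Tight-∁ tight) (cong not Cu) (cong not Cv) minW
  ... | inj₁ min = inj₁ min
  ... | inj₂ min = inj₂ (MinCut-cong deMorgan (MinCut-∁ min))
    where
    deMorgan : ∁ (∁ C ∩ ∁ W) ≗ C ∪ W
    deMorgan x with C x
    ... | true  = refl
    ... | false = not-involutive (W x)

module Laminar {n : ℕ} where

  Compatible : VSet n → VSet n → Set
  Compatible W C = C ⊆ W ⊎ Disjoint W C

  compatible-minus : ∀ {C D W} → Disjoint C D → Compatible W D → Compatible (∁ C ∩ W) D
  compatible-minus {C} C#D (inj₁ D⊆W) = inj₁ λ v Dv → cong₂ _∧_ (cong not (Disjoint-sym C#D v Dv)) (D⊆W v Dv)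
  compatible-minus {C} {W = W} C#D (inj₂ W#D) = inj₂ λ v in-both → W#D v (∧-conicalʳ (not (C v)) (W v) in-both)

  compatible-union : ∀ {C D W} → Disjoint C D → Compatible W D → Compatible (C ∪ W) D
  compatible-union {C} C#D (inj₁ D⊆W) = inj₁ λ v Dv → ∨-true (C v) (D⊆W v Dv)
  compatible-union {C} {D} {W} C#D (inj₂ W#D) = inj₂ avoid
    where
    avoid : Disjoint (C ∪ W) D
    avoid v in-either with C v in Cv
    ... | true  = C#D v Cv
    ... | false = W#D v in-either

  Core : VSet n → List (VSet n) → VSet n
  Core X L v = X v ∧ not (covered L v)

  core-inside : ∀ X L {v} → Core X L v ≡ true → X v ≡ true
  core-inside X L {v} = ∧-conicalˡ (X v) _

  core-uncovered : ∀ X L {v} → Core X L v ≡ true → covered L v ≡ false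
  core-uncovered X L {v} inCore = not-injective (∧-conicalʳ (X v) _ inCore)

  covered-inside : ∀ {X : VSet n} L → All (_⊆ X) L → ∀ {v} → covered L v ≡ true → X v ≡ true
  covered-inside (C ∷ L) (C⊆X ∷ L⊆X) {v} cov with C v in Cv
  ... | true  = C⊆X v Cv
  ... | false = covered-inside L L⊆X cov

  uncovered-by-disjoint : ∀ {C : VSet n} L → All (Disjoint C) L → ∀ {v} → C v ≡ true → covered L v ≡ false
  uncovered-by-disjoint []       []           Cv = refl
  uncovered-by-disjoint (D ∷ L) (C#D ∷ C#L) {v} Cv = ∨-false (C#D v Cv) (uncovered-by-disjoint L C#L Cv)

  sum-indicators : ∀ L → AllPairs Disjoint L → ∀ v → sumL (λ C → indicator (C v)) L ≡ indicator (covered L v)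
  sum-indicators []       []               v = refl
  sum-indicators (C ∷ L) (C#L ∷ disjoint) v with C v in Cv
  ... | true  = cong suc (trans (sum-indicators L disjoint v)
                                (cong indicator (uncovered-by-disjoint {C} L C#L Cv)))
  ... | false = sum-indicators L disjoint v

  partition : ∀ X L → All (_⊆ X) L → AllPairs Disjoint L → ∀ {r} (h : Fin r → Fin n) →
    count (λ i → X (h i)) ≡ count (λ i → Core X L (h i)) + sumL (λ C → count (λ i → C (h i))) L
  partition X L L⊆X disjoint {r} h = begin
    count (λ i → X (h i))
      ≡⟨ sumF-cong pointwise ⟩
    sumF (λ i → indicator (Core X L (h i)) + sumL (λ C → indicator (C (h i))) L)
      ≡⟨ sumF-+ {r} _ _ ⟩
    count (λ i → Core X L (h i)) + sumF (λ i → sumL (λ C → indicator (C (h i))) L)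
      ≡⟨ cong (count (λ i → Core X L (h i)) +_) (≡-sym (sumL-sumF (λ C i → indicator (C (h i))) L)) ⟩
    count (λ i → Core X L (h i)) + sumL (λ C → count (λ i → C (h i))) L
      ∎
    where
    open ≡-Reasoning
    pointwise : ∀ i → indicator (X (h i)) ≡ indicator (Core X L (h i)) + sumL (λ C → indicator (C (h i))) L
    pointwise i = trans (cover-split (X (h i)) (covered L (h i)) (covered-inside {X} L L⊆X))
                        (cong (indicator (Core X L (h i)) +_) (≡-sym (sum-indicators L disjoint (h i))))
      where
      cover-split : ∀ x c → (c ≡ true → x ≡ true) → indicator x ≡ indicator (x ∧ not c) + indicator c
      cover-split x     true  inside rewrite inside refl = refl
      cover-split true  false _ = refl
      cover-split false false _ = refl

  keep : ∀ W (L : List (VSet n)) → All (Compatible W) L → List (VSet n)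
  keep W []      []               = []
  keep W (C ∷ L) (inj₁ _ ∷ comp) = keep W L comp
  keep W (C ∷ L) (inj₂ _ ∷ comp) = C ∷ keep W L comp

  keep-All : ∀ {P : VSet n → Set} {W} L comp → All P L → All P (keep W L comp)
  keep-All []      []               []       = []
  keep-All (C ∷ L) (inj₁ _ ∷ comp) (_ ∷ ps) = keep-All L comp ps
  keep-All (C ∷ L) (inj₂ _ ∷ comp) (p ∷ ps) = p ∷ keep-All L comp ps

  keep-disjoint : ∀ {W} L comp → All (Disjoint W) (keep W L comp)
  keep-disjoint []      []                 = []
  keep-disjoint (C ∷ L) (inj₁ _   ∷ comp) = keep-disjoint L comp
  keep-disjoint (C ∷ L) (inj₂ W#C ∷ comp) = W#C ∷ keep-disjoint L comp

  keep-pairs : ∀ {W} L comp → AllPairs Disjoint L → AllPairs Disjoint (keep W L comp)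
  keep-pairs []      []               []         = []
  keep-pairs (C ∷ L) (inj₁ _ ∷ comp) (_ ∷ ds)   = keep-pairs L comp ds
  keep-pairs (C ∷ L) (inj₂ _ ∷ comp) (C# ∷ ds) = keep-All L comp C# ∷ keep-pairs L comp ds

  keep-uncovered : ∀ {W} L comp {v} → covered L v ≡ false → covered (keep W L comp) v ≡ false
  keep-uncovered []      []               _   = refl
  keep-uncovered (C ∷ L) (inj₁ _ ∷ comp) unc = keep-uncovered L comp (∨-conicalʳ _ _ unc)
  keep-uncovered (C ∷ L) (inj₂ _ ∷ comp) unc =
    ∨-false (∨-conicalˡ _ _ unc) (keep-uncovered L comp (∨-conicalʳ _ _ unc))

  keep-covers : ∀ {W} L comp {v} → W v ≡ false → covered (keep W L comp) v ≡ false → covered L v ≡ false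
  keep-covers []      []                  Wv unc = refl
  keep-covers (C ∷ L) (inj₁ C⊆W ∷ comp) Wv unc = ∨-false (outside C⊆W Wv) (keep-covers L comp Wv unc)
  keep-covers (C ∷ L) (inj₂ _ ∷ comp) Wv unc =
    ∨-false (∨-conicalˡ _ _ unc) (keep-covers L comp Wv (∨-conicalʳ _ _ unc))

-- Starting without children, a small
-- minimum cut between two core vertices is uncrossed with X and with the
-- children and becomes a new child, absorbing the children it contains; the
-- core shrinks, so the process ends with a connected core.
module Decomposition {n} (G : SimpleGraph n) (δ : ℕ) where

  open Cuts G
  open Laminar {n}

  SmallCut : Fin n → Fin n → Set
  SmallCut u v = Σ (VSet n) λ Z → MinCut u v Z × dG G Z < δ

  sameComp? : ∀ u v → SameComp G δ u v ⊎ SmallCut u v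
  sameComp? u v with u ≟ v
  ... | yes u≡v = inj₁ (inj₁ u≡v)
  ... | no  u≢v with minCut u≢v
  ...   | Z , min with δ ≤? dG G Z
  ...     | yes δ≤Z = inj₁ (inj₂ λ X sepX → ≤-trans δ≤Z (proj₂ min X sepX))
  ...     | no  δ≰Z = inj₂ (Z , min , ≰⇒> δ≰Z)

  separated-pair? : ∀ (R : VSet n) →
    Σ (Fin n) (λ u → Σ (Fin n) λ v → R u ≡ true × R v ≡ true × SmallCut u v)
    ⊎ (∀ a b → R a ≡ true → R b ≡ true → SameComp G δ a b)
  separated-pair? R = search (λ u → search (λ v → decide u v))
    where
    decide : ∀ u v → (R u ≡ true × R v ≡ true × SmallCut u v) ⊎ (R u ≡ true → R v ≡ true → SameComp G δ u v)
    decide u v with sameComp? u v | R u | R v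
    ... | inj₁ same | _     | _     = inj₂ λ _ _ → same
    ... | inj₂ cut  | true  | true  = inj₁ (refl , refl , cut)
    ... | inj₂ cut  | true  | false = inj₂ λ _ ()
    ... | inj₂ cut  | false | _     = inj₂ λ ()

  Node : VSet n → Set
  Node X = (∀ v → X v ≡ true) ⊎ Tight X

  Child : VSet n → VSet n → Set
  Child X C = Tight C × dG G C < δ × C ⊆ X

  child-node : ∀ {X C} → Child X C → Node C
  child-node (tight , _ , _) = inj₂ tight

  child-small : ∀ {X C} → Child X C → dG G C < δ
  child-small (_ , small , _) = small

  child-inside : ∀ {X C} → Child X C → C ⊆ X
  child-inside (_ , _ , C⊆X) = C⊆X

  child-nonempty : ∀ {X C} → Child X C → Σ (Fin n) λ v → C v ≡ true
  child-nonempty ((s , _ , Cs , _) , _ , _) = s , Cs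

  record Children (X : VSet n) : Set where
    field
      children : List (VSet n)
      child    : All (Child X) children
      disjoint : AllPairs Disjoint children
      witness  : Fin n
      inCore   : Core X children witness ≡ true

    core : VSet n
    core = Core X children

  open Children

  Decomposition : VSet n → Set
  Decomposition X = Σ (Children X) λ D → ∀ a b → core D a ≡ true → core D b ≡ true → SameComp G δ a b

  cut-inside : ∀ {X u v Z} → Node X → X u ≡ true → X v ≡ true → MinCut u v Z →
    Σ (VSet n) λ W → MinCut u v W × W ⊆ X
  cut-inside {Z = Z} (inj₁ full) _ _ min = Z , min , λ v _ → full v
  cut-inside {X} (inj₂ tight) Xu Xv min with uncross tight Xu Xv min
  ... | inj₁ min′ = _ , min′ , λ v → ∧-conicalˡ (X v) _
  ... | inj₂ min′ = _ , min′ , λ v → ∧-conicalˡ (X v) _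

  make-compatible : ∀ {X u v} L → All (Child X) L → AllPairs Disjoint L →
    covered L u ≡ false → covered L v ≡ false → ∀ {W} → MinCut u v W → W ⊆ X →
    Σ (VSet n) λ W′ → MinCut u v W′ × W′ ⊆ X × All (Compatible W′) L
  make-compatible [] [] [] _ _ {W} min W⊆X = W , min , W⊆X , []
  make-compatible {X} {u} {v} (C ∷ L) ((tight , _ , C⊆X) ∷ children) (C#L ∷ disjoint) Lu Lv min W⊆X
    with make-compatible L children disjoint (∨-conicalʳ (C u) _ Lu) (∨-conicalʳ (C v) _ Lv) min W⊆X
  ... | W , minW , W⊆X′ , comp with uncross-outside tight (∨-conicalˡ _ _ Lu) (∨-conicalˡ _ _ Lv) minW
  ...   | inj₁ min′ = (∁ C ∩ W) , min′ , (λ x inside → W⊆X′ x (∧-conicalʳ _ _ inside)) ,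
                      inj₂ avoids ∷ All.zipWith (λ (C#D , comp) → compatible-minus C#D comp) (C#L , comp)
    where
    avoids : Disjoint (∁ C ∩ W) C
    avoids x inside with C x
    ... | false = refl
  ...   | inj₂ min′ = (C ∪ W) , min′ , within , inj₁ (λ x Cx → cong (_∨ W x) Cx) ∷
                      All.zipWith (λ (C#D , comp) → compatible-union C#D comp) (C#L , comp)
    where
    within : (C ∪ W) ⊆ X
    within x inside with C x in Cx
    ... | true  = C⊆X x Cx
    ... | false = W⊆X′ x inside

  orient : ∀ {P : Fin n → Set} {u v W} → P u → P v → MinCut u v W →
    Σ (Fin n) λ p → Σ (Fin n) λ q → P p × P q × W p ≡ true × W q ≡ false × MinCut p q W
  orient {P = P} {u} {v} {W} Pu Pv min = by-cases (W u) (W v) refl refl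
    where
    by-cases : ∀ a b → W u ≡ a → W v ≡ b →
      Σ (Fin n) λ p → Σ (Fin n) λ q → P p × P q × W p ≡ true × W q ≡ false × MinCut p q W
    by-cases true  false Wu Wv = u , v , Pu , Pv , Wu , Wv , min
    by-cases false true  Wu Wv = v , u , Pv , Pu , Wv , Wu , MinCut-sym min
    by-cases true  true  Wu Wv = ⊥-elim (proj₁ min (trans Wu (≡-sym Wv)))
    by-cases false false Wu Wv = ⊥-elim (proj₁ min (trans Wu (≡-sym Wv)))

  refine : ∀ {X} → Node X → (D : Children X) → ∀ {u v} → core D u ≡ true → core D v ≡ true →
    SmallCut u v → Σ (Children X) λ D′ → count (core D′) < count (core D)
  refine {X} node D {u} {v} Du Dv (Z , minZ , small)
    with cut-inside node (core-inside X (children D) Du) (core-inside X (children D) Dv) minZ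
  ... | W₀ , min₀ , W₀⊆X
    with make-compatible (children D) (child D) (disjoint D)
                         (core-uncovered X (children D) Du) (core-uncovered X (children D) Dv) min₀ W₀⊆X
  ... | W , minW , W⊆X , comp
    with orient {P = λ x → core D x ≡ true} Du Dv minW
  ... | p , q , Dp , Dq , Wp , Wq , minpq = D′ , count-strict p shrinks Dp p-leaves
    where
    kept : List (VSet n)
    kept = keep W (children D) comp
    D′ : Children X
    D′ = record
      { children = W ∷ kept
      ; child    = ((p , q , Wp , Wq , minpq) , ≤-<-trans (proj₂ minW Z (proj₁ minZ)) small , W⊆X)
                   ∷ keep-All (children D) comp (child D)
      ; disjoint = keep-disjoint (children D) comp ∷ keep-pairs (children D) comp (disjoint D)
      ; witness  = q
      ; inCore   = q-stays
      }
      where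
      q-stays : Core X (W ∷ kept) q ≡ true
      q-stays = cong₂ (λ a b → a ∧ not b) (core-inside X (children D) Dq)
        (∨-false Wq (keep-uncovered (children D) comp (core-uncovered X (children D) Dq)))
    shrinks : ∀ x → core D′ x ≡ true → core D x ≡ true
    shrinks x inCore′ = cong₂ (λ a b → a ∧ not b) (core-inside X (W ∷ kept) inCore′)
      (keep-covers (children D) comp (∨-conicalˡ (W x) _ uncovered′) (∨-conicalʳ (W x) _ uncovered′))
      where
      uncovered′ : W x ∨ covered kept x ≡ false
      uncovered′ = core-uncovered X (W ∷ kept) inCore′
    p-leaves : core D′ p ≡ false
    p-leaves = cong₂ (λ a b → a ∧ not (b ∨ covered kept p)) (core-inside X (children D) Dp) Wp

  complete : ∀ {X} k → Node X → (D : Children X) → count (core D) < k → Decomposition X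
  complete zero    node D ()
  complete (suc k) node D bound with separated-pair? (core D)
  ... | inj₂ connected = D , connected
  ... | inj₁ (u , v , Du , Dv , cut) with refine node D Du Dv cut
  ...   | D′ , smaller = complete k node D′ (<-≤-trans smaller (≤-pred bound))

  decompose : ∀ {X} → Node X → (v : Fin n) → X v ≡ true → Decomposition X
  decompose {X} node v Xv = complete (suc n) node start (s≤s (count≤size _))
    where
    start : Children X
    start = record { children = [] ; child = [] ; disjoint = [] ; witness = v ; inCore = Xv-core }
      where
      Xv-core : X v ∧ true ≡ true
      Xv-core rewrite Xv = refl

module Sizes {n} (G : SimpleGraph n) (δ : ℕ) (minDegree : ∀ v → δ ≤ degree G v) where

  -- each u ∈ U has at least δ neighbours, at most |U| - 1 of them inside U
  size-bound : ∀ U → count U * suc δ ≤ dG G U + count U * count U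
  size-bound U = begin
    count U * suc δ                                    ≡⟨ ≡-sym (sumF-*ʳ (λ u → indicator (U u)) (suc δ)) ⟩
    sumF (λ u → indicator (U u) * suc δ)               ≤⟨ sumF-mono per-vertex ⟩
    sumF (λ u → exits u + indicator (U u) * count U)   ≡⟨ sumF-+ exits (λ u → indicator (U u) * count U) ⟩
    dG G U + sumF (λ u → indicator (U u) * count U)    ≡⟨ cong (dG G U +_) (sumF-*ʳ (indicator ∘ U) (count U)) ⟩
    dG G U + count U * count U                         ∎
    where
    open ≤-Reasoning
    exits : Fin n → ℕ
    exits u = count (λ v → U u ∧ (not (U v) ∧ adj G u v))
    per-vertex : ∀ u → indicator (U u) * suc δ ≤ exits u + indicator (U u) * count U
    per-vertex u with U u in Uu
    ... | false = z≤n
    ... | true  rewrite *-identityˡ (suc δ) | *-identityˡ (count U) = begin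
      suc δ                    ≤⟨ s≤s (minDegree u) ⟩
      suc (degree G u)         ≡⟨ cong suc (count-split (adj G u) U) ⟩
      suc (leaving + staying)  ≡⟨ ≡-sym (+-suc leaving staying) ⟩
      leaving + suc staying    ≤⟨ +-mono-≤ (≤-reflexive (count-cong (λ v → ∧-comm (adj G u v) _)))
                                           (count-strict u (λ v → ∧-conicalʳ (adj G u v) (U v)) Uu u-not-adjacent) ⟩
      count (λ v → not (U v) ∧ adj G u v) + count U   ∎
      where
      leaving staying : ℕ
      leaving = count (λ v → adj G u v ∧ not (U v))
      staying = count (λ v → adj G u v ∧ U v)
      u-not-adjacent : adj G u u ∧ U u ≡ false
      u-not-adjacent rewrite irrefl G u = refl

  leaf-size : ∀ U v → U v ≡ true → dG G U < δ → δ < count U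
  leaf-size U v Uv small with δ <? count U
  ... | yes large = large
  ... | no  δ≮U   = ⊥-elim (<-irrefl refl (begin-strict
    δ + count U * count U          ≤⟨ quadratic-leaf (count-pos v Uv) (≮⇒≥ δ≮U) ⟩
    count U * suc δ                ≤⟨ size-bound U ⟩
    dG G U + count U * count U     <⟨ +-monoˡ-< (count U * count U) small ⟩
    δ + count U * count U          ∎))
    where open ≤-Reasoning

  chain-size : ∀ U → 3 ≤ count U → dG G U < δ + δ → δ ≤ count U + count U
  chain-size U three small with δ ≤? count U + count U
  ... | yes large = large
  ... | no  δ≰2U  = ⊥-elim (<-irrefl refl (begin-strict
    count U * suc δ                ≤⟨ size-bound U ⟩
    dG G U + count U * count U     <⟨ +-monoˡ-< (count U * count U) small ⟩
    δ + δ + count U * count U      <⟨ quadratic-chain three (≰⇒> δ≰2U) ⟩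
    count U * suc δ                ∎))
    where open ≤-Reasoning

-- A measure Q on vertex sets that grows by at most
-- c₀ per decomposition plus c₁ per child is at most linear in the size:
-- a node whose decomposition is a leaf has more than δ vertices, a node
-- with at least two children absorbs the overhead, and three nested single
-- children enclose at least δ/2 vertices between the top and the bottom.
module Counting {n} (G : SimpleGraph n) (δ : ℕ) (minDegree : ∀ v → δ ≤ degree G v)
  (Q : VSet n → ℕ) (c₀ c₁ a : ℕ) (room : 6 * (c₀ + c₁) ≤ a * δ)
  (recursive : ∀ X (D : Decomposition.Decomposition G δ X) →
               Q X ≤ c₀ + sumL (λ C → Q C + c₁) (Decomposition.Children.children (proj₁ D)))
  where

  open Cuts G
  open Laminar {n}
  open Decomposition G δ
  open Children
  open Sizes G δ minDegree

  K : ℕ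
  K = c₀ + c₁

  NonEmpty : VSet n → Set
  NonEmpty X = Σ (Fin n) λ v → X v ≡ true

  -- the invariant to prove, and a stronger one holding at nodes without a single child
  Good Strong : VSet n → Set
  Good   X = Q X + 3 * K + c₁ ≤ a * count X
  Strong X = Q X + 5 * K + c₁ ≤ a * count X

  Below : VSet n → Set
  Below X = ∀ {C} → count C < count X → Node C → dG G C < δ → NonEmpty C → Good C

  data Shape (X : VSet n) : Set where
    strong : Strong X → Shape X
    single : ∀ Y → Child X Y → Q X ≤ K + Q Y → ∀ r → X r ≡ true → Y r ≡ false → Shape X

  strong⇒good : ∀ {X} → Strong X → Good X
  strong⇒good {X} s = ≤-trans (+-monoˡ-≤ c₁ (+-monoʳ-≤ (Q X) (*-monoˡ-≤ K {3} {5} (≤ᵇ⇒≤ 3 5 _)))) s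

  -- a childless node has more than δ vertices, which pays for 6K
  leaf-strong : ∀ {X} → Q X ≤ c₀ + 0 → δ < count X → Strong X
  leaf-strong {X} bound large = begin
    Q X + 5 * K + c₁          ≤⟨ +-monoˡ-≤ c₁ (+-monoˡ-≤ (5 * K) bound) ⟩
    c₀ + 0 + 5 * K + c₁       ≡⟨ identity c₀ c₁ ⟩
    6 * K                     ≤⟨ room ⟩
    a * δ                     ≤⟨ *-monoʳ-≤ a (<⇒≤ large) ⟩
    a * count X               ∎
    where
    open ≤-Reasoning
    identity : ∀ c₀ c₁ → c₀ + 0 + 5 * (c₀ + c₁) + c₁ ≡ 6 * (c₀ + c₁)
    identity = solve-∀

  sum-good : ∀ L → All Good L → sumL (λ C → Q C + c₁) L + length L * (3 * K) ≤ a * sumL count L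
  sum-good []      []           = z≤n
  sum-good (C ∷ L) (good ∷ goods) = begin
    (Q C + c₁ + S) + (3 * K + length L * (3 * K))    ≡⟨ regroup (Q C) c₁ S (3 * K) (length L * (3 * K)) ⟩
    (Q C + 3 * K + c₁) + (S + length L * (3 * K))    ≤⟨ +-mono-≤ good (sum-good L goods) ⟩
    a * count C + a * sumL count L                    ≡⟨ ≡-sym (*-distribˡ-+ a (count C) _) ⟩
    a * (count C + sumL count L)                      ∎
    where
    open ≤-Reasoning
    S = sumL (λ C → Q C + c₁) L
    regroup : ∀ q c s k t → (q + c + s) + (k + t) ≡ (q + k + c) + (s + t)
    regroup = solve-∀

  -- two or more good children leave slack 6K ≥ c₀ + 5K + c₁
  branching-strong : ∀ {X} L → 2 ≤ length L → All Good L → Q X ≤ c₀ + sumL (λ C → Q C + c₁) L →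
    sumL count L ≤ count X → Strong X
  branching-strong {X} L two goods bound fits = begin
    Q X + 5 * K + c₁                                   ≤⟨ +-monoˡ-≤ c₁ (+-monoˡ-≤ (5 * K) bound) ⟩
    c₀ + S + 5 * K + c₁                                ≡⟨ regroup c₀ c₁ S ⟩
    S + 2 * (3 * K)                                    ≤⟨ +-monoʳ-≤ S (*-monoˡ-≤ (3 * K) two) ⟩
    S + length L * (3 * K)                             ≤⟨ sum-good L goods ⟩
    a * sumL count L                                   ≤⟨ *-monoʳ-≤ a fits ⟩
    a * count X                                        ∎
    where
    open ≤-Reasoning
    S = sumL (λ C → Q C + c₁) L
    regroup : ∀ c₀ c₁ s → c₀ + s + 5 * (c₀ + c₁) + c₁ ≡ s + 2 * (3 * (c₀ + c₁))
    regroup = solve-∀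

  smaller : ∀ {X Y r} → Child X Y → X r ≡ true → Y r ≡ false → count Y < count X
  smaller {r = r} child Xr Yr = count-strict r (child-inside child) Xr Yr

  below-child : ∀ {X Y r} → Child X Y → X r ≡ true → Y r ≡ false → Below X → Below Y
  below-child child Xr Yr below lt = below (<-trans lt (smaller child Xr Yr))

  lift : ∀ {X Y} → Q X ≤ K + (K + Q Y) → count Y ≤ count X → Strong Y → Good X
  lift {X} {Y} bound Y≤X s = begin
    Q X + 3 * K + c₁               ≤⟨ +-monoˡ-≤ c₁ (+-monoˡ-≤ (3 * K) bound) ⟩
    K + (K + Q Y) + 3 * K + c₁     ≡⟨ regroup K (Q Y) c₁ ⟩
    Q Y + 5 * K + c₁               ≤⟨ s ⟩
    a * count Y                    ≤⟨ *-monoʳ-≤ a Y≤X ⟩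
    a * count X                    ∎
    where
    open ≤-Reasoning
    regroup : ∀ k q c → k + (k + q) + 3 * k + c ≡ q + 5 * k + c
    regroup = solve-∀

  wide-gap : ∀ U → 3 ≤ count U → dG G U < δ + δ → 3 * K ≤ a * count U
  wide-gap U three small = *-cancelˡ-≤ 2 (begin
    2 * (3 * K)                ≡⟨ six K ⟩
    6 * K                      ≤⟨ room ⟩
    a * δ                      ≤⟨ *-monoʳ-≤ a (chain-size U three small) ⟩
    a * (count U + count U)    ≡⟨ double a (count U) ⟩
    2 * (a * count U)          ∎)
    where
    open ≤-Reasoning
    six : ∀ k → 2 * (3 * k) ≡ 6 * k
    six = solve-∀
    double : ∀ a u → a * (u + u) ≡ 2 * (a * u)
    double = solve-∀

  -- Three nested single children X ⊃ Y ⊃ Z ⊃ W: the set X ∖ W has the three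
  -- points r, r′, r″ and fewer than 2δ boundary edges, so it has at least δ/2
  -- vertices, which pays for the three levels.
  chain : ∀ {X Y Z W r r′ r″} → Child X Y → Child Y Z → Child Z W → dG G X < δ →
    X r ≡ true → Y r ≡ false → Y r′ ≡ true → Z r′ ≡ false → Z r″ ≡ true → W r″ ≡ false →
    Q X ≤ K + (K + (K + Q W)) → Good W → Good X
  chain {X} {Y} {Z} {W} {r} {r′} {r″} chY chZ chW small Xr Yr Yr′ Zr′ Zr″ Wr″ bound goodW = begin
    Q X + 3 * K + c₁                         ≤⟨ +-monoˡ-≤ c₁ (+-monoˡ-≤ (3 * K) bound) ⟩
    K + (K + (K + Q W)) + 3 * K + c₁         ≡⟨ regroup K (Q W) c₁ ⟩
    3 * K + (Q W + 3 * K + c₁)               ≤⟨ +-mono-≤ (wide-gap U three (≤-<-trans (dG-diff X W)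
                                                             (+-mono-< small (child-small chW)))) goodW ⟩
    a * count U + a * count W                ≡⟨ ≡-sym (*-distribˡ-+ a (count U) (count W)) ⟩
    a * (count U + count W)                  ≡⟨ cong (a *_) (≡-sym (count-difference W⊆X)) ⟩
    a * count X                              ∎
    where
    open ≤-Reasoning
    regroup : ∀ k q c → k + (k + (k + q)) + 3 * k + c ≡ 3 * k + (q + 3 * k + c)
    regroup = solve-∀
    Z⊆Y : Z ⊆ Y
    Z⊆Y = child-inside chZ
    W⊆Z : W ⊆ Z
    W⊆Z = child-inside chW
    W⊆X : W ⊆ X
    W⊆X v Wv = child-inside chY v (Z⊆Y v (W⊆Z v Wv))
    U : VSet n
    U = X ∩ ∁ W
    in-U : ∀ {v} → X v ≡ true → W v ≡ false → U v ≡ true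
    in-U Xv Wv rewrite Xv | Wv = refl
    three : 3 ≤ count U
    three = count-three {P = U} (in-U Xr (outside W⊆Z (outside Z⊆Y Yr)))
                        (in-U (child-inside chY r′ Yr′) (outside W⊆Z Zr′))
                        (in-U (Z⊆X r″ Zr″) Wr″)
                        (differ {S = Y} Yr Yr′) (differ {S = Y} Yr (Z⊆Y r″ Zr″)) (differ {S = Z} Zr′ Zr″)
      where
      Z⊆X : Z ⊆ X
      Z⊆X v Zv = child-inside chY v (Z⊆Y v Zv)

  children-smaller : ∀ {m} L → sumL (count {n}) L < m → All (λ C → count C < m) L
  children-smaller []      _  = []
  children-smaller (C ∷ L) lt =
    ≤-<-trans (m≤m+n (count C) _) lt ∷ children-smaller L (≤-<-trans (m≤n+m _ (count C)) lt)

  shape : ∀ {X} → Node X → dG G X < δ → NonEmpty X → Below X → Shape X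
  shape {X} node small (v , Xv) below with decompose node v Xv
  ... | D , connected =
    classify (children D) (child D) (recursive X (D , connected)) (inCore D)
             (partition X (children D) (All.map child-inside (child D)) (disjoint D) (λ i → i))
    where
    classify : ∀ L → All (Child X) L → Q X ≤ c₀ + sumL (λ C → Q C + c₁) L → Core X L (witness D) ≡ true →
               count X ≡ count (Core X L) + sumL count L → Shape X
    classify [] [] bound _ _ = strong (leaf-strong bound (leaf-size X v Xv small))
    classify (Y ∷ []) (chY ∷ []) bound inCore _ =
      single Y chY (≤-trans bound (≤-reflexive (regroup c₀ (Q Y) c₁))) (witness D)
             (core-inside X (Y ∷ []) inCore) (∨-conicalˡ (Y (witness D)) false (core-uncovered X (Y ∷ []) inCore))
      where
      regroup : ∀ c₀ q c₁ → c₀ + (q + c₁ + 0) ≡ c₀ + c₁ + q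
      regroup = solve-∀
    classify L@(_ ∷ _ ∷ _) children bound inCore sizes =
      strong (branching-strong L (s≤s (s≤s z≤n)) goods bound (<⇒≤ fits))
      where
      fits : sumL count L < count X
      fits = ≤-trans (+-monoˡ-≤ (sumL count L) (count-pos (witness D) inCore)) (≤-reflexive (≡-sym sizes))
      goods : All Good L
      goods = All.zipWith (λ (ch , lt) → below lt (child-node ch) (child-small ch) (child-nonempty ch))
                          (children , children-smaller L fits)

  good-step : ∀ {X} → Below X → Node X → dG G X < δ → NonEmpty X → Good X
  good-step {X} below node small nonempty with shape node small nonempty below
  ... | strong s = strong⇒good s
  ... | single Y chY QX≤ r Xr Yr
    with shape (child-node chY) (child-small chY) (child-nonempty chY) (below-child chY Xr Yr below)
  ... | strong s = lift (≤-trans QX≤ (+-monoʳ-≤ K (m≤n+m (Q Y) K))) (<⇒≤ (smaller chY Xr Yr)) s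
  ... | single Z chZ QY≤ r′ Yr′ Zr′
    with shape (child-node chZ) (child-small chZ) (child-nonempty chZ)
               (below-child chZ Yr′ Zr′ (below-child chY Xr Yr below))
  ... | strong s = lift (≤-trans QX≤ (+-monoʳ-≤ K QY≤))
                        (<⇒≤ (<-trans (smaller chZ Yr′ Zr′) (smaller chY Xr Yr))) s
  ... | single W chW QZ≤ r″ Zr″ Wr″ =
    chain chY chZ chW small Xr Yr Yr′ Zr′ Zr″ Wr″
          (≤-trans QX≤ (+-monoʳ-≤ K (≤-trans QY≤ (+-monoʳ-≤ K QZ≤))))
          (below (<-trans (smaller chW Zr″ Wr″) (<-trans (smaller chZ Yr′ Zr′) (smaller chY Xr Yr)))
                 (child-node chW) (child-small chW) (child-nonempty chW))

  good : ∀ k {X} → count X < k → Node X → dG G X < δ → NonEmpty X → Good X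
  good zero    ()
  good (suc k) bound = good-step (λ lt → good k (<-≤-trans lt (≤-pred bound)))

  measure-bound : 0 < δ → Fin n → Q (λ _ → true) ≤ a * n
  measure-bound δ>0 v = begin
    Q V                        ≤⟨ ≤-trans (m≤m+n _ c₁) (≤-trans (+-monoˡ-≤ c₁ (m≤m+n (Q V) (3 * K))) goodV) ⟩
    a * count V                ≡⟨ cong (a *_) (count-full V (λ _ → refl)) ⟩
    a * n                      ∎
    where
    open ≤-Reasoning
    V : VSet n
    V _ = true
    goodV : Good V
    goodV = good (suc n) (s≤s (count≤size V)) (inj₁ (λ _ → refl)) (subst (_< δ) (≡-sym no-boundary) δ>0) (v , refl)
      where
      no-boundary : dG G V ≡ 0
      no-boundary = sumF-zero {n} (λ u → sumF-zero {n} (λ v → refl))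

module Representatives {n} (G : SimpleGraph n) (δ : ℕ) {r} (f : Fin r → Fin n)
  (apart : ∀ i j → i ≢ j → ¬ SameComp G δ (f i) (f j)) where

  open Laminar {n}
  open Decomposition G δ
  open Children

  hits : VSet n → ℕ
  hits X = count (λ i → X (f i))

  -- a connected core contains at most one representative, so the count at X
  -- exceeds the total count over the children by at most one
  hits-recursive : ∀ X (D : Decomposition X) → δ * hits X ≤ δ + sumL (λ C → δ * hits C + 0) (children (proj₁ D))
  hits-recursive X (D , connected) = begin
    δ * hits X                                       ≡⟨ cong (δ *_) split ⟩
    δ * (hits (core D) + sumL hits L)                ≤⟨ *-monoʳ-≤ δ (+-monoˡ-≤ (sumL hits L) core-hits) ⟩
    δ * (1 + sumL hits L)                            ≡⟨ *-distribˡ-+ δ 1 (sumL hits L) ⟩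
    δ * 1 + δ * sumL hits L                          ≡⟨ cong₂ _+_ (*-identityʳ δ) (sumL-*ˡ δ hits L) ⟩
    δ + sumL (λ C → δ * hits C) L                    ≡⟨ cong (δ +_) (sumL-cong L (λ C → ≡-sym (+-identityʳ _))) ⟩
    δ + sumL (λ C → δ * hits C + 0) L                ∎
    where
    open ≤-Reasoning
    L : List (VSet n)
    L = children D
    split : hits X ≡ hits (core D) + sumL hits L
    split = partition X L (All.map child-inside (child D)) (disjoint D) f
    core-hits : hits (core D) ≤ 1
    core-hits = count≤1 (λ i → core D (f i)) same
      where
      same : ∀ i j → core D (f i) ≡ true → core D (f j) ≡ true → i ≡ j
      same i j in-i in-j with i ≟ j
      ... | yes i≡j = i≡j
      ... | no  i≢j = ⊥-elim (apart i j i≢j (connected (f i) (f j) in-i in-j))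

module SurvivingEdges {n} (G : SimpleGraph n) (δ : ℕ) {r} (g : Fin r → Fin n × Fin n)
  (injective : ∀ i j → g i ≡ g j → i ≡ j) (surviving : ∀ i → SurvivingEdge G δ (g i)) where

  open Cuts G
  open Laminar {n}
  open Decomposition G δ
  open Children

  lower upper : Fin r → Fin n
  lower i = proj₁ (g i)
  upper i = proj₂ (g i)

  inside : VSet n → ℕ
  inside X = count (λ i → X (lower i) ∧ X (upper i))

  meets : VSet n → Fin r → ℕ
  meets C i = indicator (C (lower i) ∧ C (upper i)) + (crossing C (lower i) (upper i) + crossing C (upper i) (lower i))

  crossings-bound : ∀ C →
    sumF (λ i → crossing C (lower i) (upper i) + crossing C (upper i) (lower i)) ≤ dG G C + dG G C
  crossings-bound C = begin
    sumF (λ i → crossing C (lower i) (upper i) + crossing C (upper i) (lower i))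
      ≡⟨ sumF-+ (λ i → crossing C (lower i) (upper i)) (λ i → crossing C (upper i) (lower i)) ⟩
    sumF (λ i → crossing C (lower i) (upper i)) + sumF (λ i → crossing C (upper i) (lower i))
      ≤⟨ +-mono-≤ (sumF-injective-pairs g injective (crossing C))
                  (sumF-injective-pairs g injective (λ u v → crossing C v u)) ⟩
    dG G C + sumF (λ u → sumF (λ v → crossing C v u))
      ≡⟨ cong (dG G C +_) (≡-sym (sumF-swap (crossing C))) ⟩
    dG G C + dG G C
      ∎
    where open ≤-Reasoning

  meets-touching : ∀ C i → C (lower i) ≡ true ⊎ C (upper i) ≡ true → 1 ≤ meets C i
  meets-touching C i end with C (lower i) | C (upper i) | proj₁ (proj₂ (surviving i))
  ... | true  | true  | _    = s≤s z≤n
  ... | true  | false | edge rewrite edge = s≤s z≤n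
  ... | false | true  | edge rewrite SimpleGraph.sym G (upper i) (lower i) | edge = s≤s z≤n
  ... | false | false | _    = ⊥-elim ([ (λ ()) , (λ ()) ] end)

  meets-covered : ∀ L i → covered L (lower i) ≡ true ⊎ covered L (upper i) ≡ true → 1 ≤ sumL (λ C → meets C i) L
  meets-covered (C ∷ L) i (inj₁ cov) with ∨-true-elim (C (lower i)) cov
  ... | inj₁ Cu   = ≤-trans (meets-touching C i (inj₁ Cu)) (m≤m+n _ _)
  ... | inj₂ cov′ = ≤-trans (meets-covered L i (inj₁ cov′)) (m≤n+m _ _)
  meets-covered (C ∷ L) i (inj₂ cov) with ∨-true-elim (C (upper i)) cov
  ... | inj₁ Cv   = ≤-trans (meets-touching C i (inj₂ Cv)) (m≤m+n _ _)
  ... | inj₂ cov′ = ≤-trans (meets-covered L i (inj₂ cov′)) (m≤n+m _ _)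

  -- an edge of the family inside X cannot lie in the connected core, as it
  -- survives the contraction, so it meets a child
  inside-recursive : ∀ X (D : Decomposition X) → inside X ≤ 0 + sumL (λ C → inside C + (δ + δ)) (children (proj₁ D))
  inside-recursive X (D , connected) = begin
    inside X                                   ≤⟨ sumF-mono per-edge ⟩
    sumF (λ i → sumL (λ C → meets C i) L)      ≡⟨ ≡-sym (sumL-sumF meets L) ⟩
    sumL (λ C → sumF (meets C)) L              ≤⟨ sumL-mono (child D) per-child ⟩
    sumL (λ C → inside C + (δ + δ)) L          ∎
    where
    open ≤-Reasoning
    L : List (VSet n)
    L = children D
    per-child : ∀ {C} → Child X C → sumF (meets C) ≤ inside C + (δ + δ)
    per-child {C} child = begin
      sumF (meets C)        ≡⟨ sumF-+ (λ i → indicator (C (lower i) ∧ C (upper i))) crossings ⟩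
      inside C + sumF crossings
                            ≤⟨ +-monoʳ-≤ (inside C) (≤-trans (crossings-bound C)
                                 (+-mono-≤ (<⇒≤ (child-small child)) (<⇒≤ (child-small child)))) ⟩
      inside C + (δ + δ)    ∎
      where
      crossings : Fin r → ℕ
      crossings i = crossing C (lower i) (upper i) + crossing C (upper i) (lower i)
    per-edge : ∀ i → indicator (X (lower i) ∧ X (upper i)) ≤ sumL (λ C → meets C i) L
    per-edge i with X (lower i) in Xu | X (upper i) in Xv
    ... | false | _     = z≤n
    ... | true  | false = z≤n
    ... | true  | true  with covered L (lower i) in cu | covered L (upper i) in cv
    ...   | true  | _    = meets-covered L i (inj₁ cu)
    ...   | false | true = meets-covered L i (inj₂ cv)
    ...   | false | false = ⊥-elim (proj₂ (proj₂ (surviving i)) (connected (lower i) (upper i)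
                              (cong₂ (λ a b → a ∧ not b) Xu cu) (cong₂ (λ a b → a ∧ not b) Xv cv)))

components-bound : ∀ {n} (G : SimpleGraph n) δ → (∀ v → δ ≤ degree G v) → 0 < δ → Fin n →
  ∀ r (f : Fin r → Fin n) → (∀ i j → i ≢ j → ¬ SameComp G δ (f i) (f j)) → r * δ ≤ 6 * n
components-bound {n} G δ minDegree δ>0 v r f apart = begin
  r * δ                    ≡⟨ *-comm r δ ⟩
  δ * r                    ≡⟨ cong (δ *_) (≡-sym (count-full {r} (λ _ → true) (λ _ → refl))) ⟩
  δ * hits (λ _ → true)    ≤⟨ Counting.measure-bound G δ minDegree (λ X → δ * hits X) δ 0 6
                                (≤-reflexive (cong (6 *_) (+-identityʳ δ))) hits-recursive δ>0 v ⟩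
  6 * n                    ∎
  where
  open ≤-Reasoning
  open Representatives G δ f apart

edges-bound : ∀ {n} (G : SimpleGraph n) δ → (∀ v → δ ≤ degree G v) → 0 < δ → Fin n →
  ContractedEdgesAtMost G δ (12 * n)
edges-bound {n} G δ minDegree δ>0 v r g injective surviving = begin
  r                        ≡⟨ ≡-sym (count-full {r} (λ _ → true) (λ _ → refl)) ⟩
  inside (λ _ → true)      ≤⟨ Counting.measure-bound G δ minDegree inside 0 (δ + δ) 12
                                (≤-reflexive (twelve δ)) inside-recursive δ>0 v ⟩
  12 * n                   ∎
  where
  open ≤-Reasoning
  open SurvivingEdges G δ g injective surviving
  twelve : ∀ d → 6 * (0 + (d + d)) ≡ 12 * d
  twelve = solve-∀

≤-quotient : ∀ {r N δ} .{{_ : NonZero δ}} → r * δ ≤ N → r ≤ N / δ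
≤-quotient {r} {N} {δ} rδ≤N = subst (_≤ N / δ) (m*n/n≡m r δ) (/-monoˡ-≤ δ rδ≤N)

theorem4 : Σ ℕ (λ c → (0 < c) ×
             ((n : ℕ) (G : SimpleGraph n) (δ : ℕ) → IsMinDegree G δ → 0 < δ →
               (Σ ℕ (λ m → ContractedVerticesAtMost G δ m × m * δ ≤ c * n))
               × ContractedEdgesAtMost G δ (c * n)))
theorem4 = 12 , s≤s z≤n , bounds
  where
  bounds : (n : ℕ) (G : SimpleGraph n) (δ : ℕ) → IsMinDegree G δ → 0 < δ →
    (Σ ℕ (λ m → ContractedVerticesAtMost G δ m × m * δ ≤ 12 * n)) × ContractedEdgesAtMost G δ (12 * n)
  bounds n G δ@(suc _) (minDegree , v , _) δ>0 =
    ( (6 * n) / δ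
    , (λ r f apart → ≤-quotient (components-bound G δ minDegree δ>0 v r f apart))
    , ≤-trans (m/n*n≤m (6 * n) δ) (*-monoˡ-≤ n (≤ᵇ⇒≤ 6 12 _)) )
    , edges-bound G δ minDegree δ>0 v
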